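{- Let $A_{n,m}$ be the subgroup of $\mathrm{Aut}(Y_{n,m})$ generated by $\varphi,\psi,\tau$. Then: 1. $A_{1,0}$ is trivial and $A_{2,0}\cong A_{1,1}\cong C_2$. 2. $A_{n,0}\cong D_n$ for all $n>2$. 3. $A_{1,m}\cong C_2\times C_2$ for all $m>1$. 4. If $n>1$ and $m>0$: (a) if at least one of $n,m$ is odd, then $A_{n,m}\cong D_{2n}$; (b) otherwise ($n,m$ both even) $A_{n,m}\cong D_n\times C_2$.
   Context: For integers $n\geq 1$, $m\geq 0$, the Yoke graph $Y_{n,m}$ is the simple graph whose vertices are the tuples $v=(v_0,\dots,v_{m+1})$ with $v_0,v_{m+1}\in\mathbb{Z}_n$, $v_1,\dots,v_m\in\{0,1\}$, and $\sum_{i=0}^{m+1}v_i\equiv 0 \pmod n$; $u,v$ are adjacent iff for some $0\leq i\leq m$, $u_j=v_j$ for $j\notin\{i,i+1\}$ and $(u_i,u_{i+1})=(v_i\pm1,v_{i+1}\mp1)$ (bucket coordinates $0,m+1$ computed in $\mathbb{Z}_n$, entries staying in their allowed sets). Define maps on vertices: $\varphi(v_0,v_1,\dots,v_m,v_{m+1})=(v_0+1,v_1,\dots,v_m,v_{m+1}-1)$; $\psi(v_0,\dots,v_{m+1})=(v_{m+1},v_m,\dots,v_1,v_0)$; $\tau(v_0,v_1,\dots,v_m,v_{m+1})=(-v_0,1-v_1,\dots,1-v_m,-(m+v_{m+1}))$, with bucket arithmetic in $\mathbb{Z}_n$. These are automorphisms of $Y_{n,m}$. $C_2$ is the cyclic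 group of order 2 and $D_k$ the dihedral group of order $2k$, $D_k=\langle g,h\mid g^k=h^2=1,\ hgh=g^{ -1}\rangle$. -}

module Defs where

open import Data.Nat using (ℕ; zero; suc; _+_; _*_; _∸_; _<_)
open import Data.Nat.DivMod using (_mod_)
open import Data.Nat.Divisibility using (_∣_)
open import Data.Fin using (Fin; toℕ)
open import Data.Bool using (Bool; true; false; not; _xor_; if_then_else_)
open import Data.Vec using (Vec; []; _∷_; map; reverse)
open import Data.List using (List; []; _∷_; _++_)
open import Data.Product using (_×_; _,_; ∃)
open import Relation.Binary.PropositionalEquality using (_≡_)

-- Arithmetic in ℤ_n, realised on Fin n (n ≥ 1 is forced by Fin n being
-- inhabited; the n = 0 clauses are absurd).

addℕ : ∀ {n} → ℕ → Fin n → Fin n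
addℕ {suc k} c i = (c + toℕ i) mod suc k

_⊕_ : ∀ {n} → Fin n → Fin n → Fin n
i ⊕ j = addℕ (toℕ i) j

neg : ∀ {n} → Fin n → Fin n
neg {suc k} i = (suc k ∸ toℕ i) mod suc k

inc : ∀ {n} → Fin n → Fin n
inc i = addℕ 1 i

dec : ∀ {n} → Fin n → Fin n
dec {suc k} i = addℕ k i

-- Vertices of the Yoke graph Y_{n,m}.
-- A tuple (v_0, v_1..v_m, v_{m+1}) is represented as (v_0 , bits , v_{m+1})
-- with bits ∈ {0,1}^m encoded by Bool (false = 0, true = 1).

bit : Bool → ℕ
bit false = 0
bit true  = 1

sumBits : ∀ {m} → Vec Bool m → ℕ
sumBits []       = 0
sumBits (b ∷ bs) = bit b + sumBits bs

Tuple : ℕ → ℕ → Set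
Tuple n m = Fin n × Vec Bool m × Fin n

IsVertex : ∀ {n m} → Tuple n m → Set
IsVertex {n} (a , bs , b) = n ∣ (toℕ a + sumBits bs + toℕ b)

-- The maps φ, φ⁻¹, ψ, τ  (φ⁻¹ is the inverse of φ, included so that words
-- generate the subgroup rather than only a submonoid).

φ : ∀ {n m} → Tuple n m → Tuple n m
φ (a , bs , b) = (inc a , bs , dec b)

φ⁻¹ : ∀ {n m} → Tuple n m → Tuple n m
φ⁻¹ (a , bs , b) = (dec a , bs , inc b)

ψ : ∀ {n m} → Tuple n m → Tuple n m
ψ (a , bs , b) = (b , reverse bs , a)

τ : ∀ {n m} → Tuple n m → Tuple n m
τ {n} {m} (a , bs , b) = (neg a , map not bs , neg (addℕ m b))

data Letter : Set where
  `φ `φ⁻¹ `ψ `τ : Letter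

Word : Set
Word = List Letter

apply : ∀ {n m} → Letter → Tuple n m → Tuple n m
apply `φ   = φ
apply `φ⁻¹ = φ⁻¹
apply `ψ   = ψ
apply `τ   = τ

act : ∀ {n m} → Word → Tuple n m → Tuple n m
act []      v = v
act (l ∷ w) v = apply l (act w v)

-- Two words give the same automorphism of Y_{n,m}: they agree on every vertex.
-- The group A_{n,m} is Word modulo this relation, with product _++_ (composition).
SameIn : (n m : ℕ) → Word → Word → Set
SameIn n m w w' = (v : Tuple n m) → IsVertex v → act w v ≡ act w' v

-- A_{n,m} ≅ G, for a group G given concretely by carrier and multiplication:
-- a map from words onto G, multiplicative, and with f w ≡ f w' exactly when
-- w, w' define the same automorphism (i.e. a bijective homomorphism A_{n,m} → G).

record A≅ (n m : ℕ) (G : Set) (_·_ : G → G → G) : Set where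
  field
    f    : Word → G
    hom  : ∀ w w' → f (w ++ w') ≡ f w · f w'
    wd   : ∀ w w' → SameIn n m w w' → f w ≡ f w'
    inj  : ∀ w w' → f w ≡ f w' → SameIn n m w w'
    surj : ∀ g → ∃ λ w → f w ≡ g

C₂ : Set
C₂ = Bool

_·C₂_ : C₂ → C₂ → C₂
_·C₂_ = _xor_

-- D_k (order 2k): element (i , s) stands for g^i h^s  (s = true means h).
-- (g^i h^s)(g^j h^t) = g^(i + (-1)^s j) h^(s+t)
D : ℕ → Set
D k = Fin k × Bool

_·D_ : ∀ {k} → D k → D k → D k
(i , s) ·D (j , t) = (i ⊕ (if s then neg j else j) , s xor t)

_·×_ : ∀ {G H : Set} → (G → G → G) → (H → H → H) → (G × H → G × H → G × H)
(_*G_ ·× _*H_) (g , h) (g' , h') = (g *G g' , h *H h')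

-- Each group G in the statement is realised by a faithful action on the vertices in which
-- every letter acts as the corresponding map; evaluating words in G is then an isomorphism
-- from A_{n,m} onto G.
--
-- For n = 1 the buckets are trivial, so φ = 1 while ψ and τ are commuting involutions (and
-- ψ = 1 when m = 1). For m = 0 the vertices satisfy v₁ = -v₀, on which ψ = τ, so the group is
-- generated by the rotation φ of order n and the reflection ψ. In general, with Ξ = φ⁻ᵏτψ, a
-- direct computation gives Ξ² = φᵈ and ψΞ = φ⁻ᵈΞψ whenever m ≡ d + 2k (mod n). If n or m is
-- odd we may take d = 1: then Ξ is a square root of φ of order 2n inverted by ψ, and
-- ⟨Ξ, ψ⟩ = D_{2n}. If both are even, d = 0 and k = m/2 make Ξ a central involution, and the
-- group is ⟨φ, ψ⟩ × ⟨Ξ⟩ = D_n × C₂.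

module Submission where

open import Defs
open import Data.Nat using (ℕ; _<_; _*_)
open import Data.Product using (_×_)
open import Data.Sum using (_⊎_)
open import Data.List using ([])
open import Data.Nat.Divisibility using (_∣_)
open import Relation.Nullary using (¬_)

open import Data.Bool using (Bool; true; false; not; _xor_; if_then_else_)
open import Data.Bool.Properties using (not-involutive; not-¬)
open import Data.Empty using (⊥-elim)
open import Data.Fin as F using (Fin; toℕ)
open import Data.Fin.Properties using (toℕ-fromℕ<; toℕ-fromℕ; toℕ-injective; toℕ<n; toℕ≤n)
open import Data.Integer as ℤ using (ℤ; +_; -[1+_])
import Data.Integer.Properties as ℤP
open import Data.Integer.Tactic.RingSolver using (solve-∀)
open import Data.List using (_∷_; _++_)
open import Data.Nat as ℕ using (zero; suc; s≤s; ⌊_/2⌋)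
import Data.Nat.Properties as ℕP
open import Data.Nat.Divisibility using (divides)
open import Data.Nat.DivMod using (_/_; m≡m%n+[m/n]*n; m%n<n; _mod_)
open import Data.Product using (Σ; _,_; proj₁; proj₂)
open import Data.Sum using (inj₁; inj₂)
open import Data.Unit using (⊤)
open import Data.Vec as Vec using (Vec; []; _∷_; map; reverse; replicate)
open import Data.Vec.Properties using (map-∘; map-cong; map-id; map-reverse; reverse-involutive; map-const; map-replicate; reverse-∷)
open import Relation.Binary.PropositionalEquality
open import Function using (_∘_)
open import Relation.Binary.Bundles using (Setoid)
import Relation.Binary.Reasoning.Setoid as ≈-Reasoning
open import Level using (0ℓ)

module _ {A : Set} where

  infixr 8 _^_
  _^_ : (A → A) → ℕ → A → A
  (f ^ zero) x = x
  (f ^ suc t) x = f ((f ^ t) x)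

  ^-+ : ∀ (f : A → A) a b (x : A) → (f ^ (a ℕ.+ b)) x ≡ (f ^ a) ((f ^ b) x)
  ^-+ f zero b x = refl
  ^-+ f (suc a) b x = cong f (^-+ f a b x)

  ^-commute : ∀ (f g : A → A) → (∀ x → g (f x) ≡ f (g x)) → ∀ t (x : A) → (g ^ t) (f x) ≡ f ((g ^ t) x)
  ^-commute f g gf≡fg zero x = refl
  ^-commute f g gf≡fg (suc t) x = trans (cong g (^-commute f g gf≡fg t x)) (gf≡fg _)

  ^-suc′ : ∀ (f : A → A) t (x : A) → (f ^ t) (f x) ≡ f ((f ^ t) x)
  ^-suc′ f = ^-commute f f (λ x → refl)

  ^-cancel : ∀ (f g : A → A) → (∀ x → g (f x) ≡ x) → ∀ t (x : A) → (g ^ t) ((f ^ t) x) ≡ x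
  ^-cancel f g gf≡id zero x = refl
  ^-cancel f g gf≡id (suc t) x = begin
    (g ^ suc t) (f ((f ^ t) x)) ≡⟨ ^-suc′ g t _ ⟨
    (g ^ t) (g (f ((f ^ t) x))) ≡⟨ cong (g ^ t) (gf≡id _) ⟩
    (g ^ t) ((f ^ t) x)         ≡⟨ ^-cancel f g gf≡id t x ⟩
    x                           ∎
    where open ≡-Reasoning

  ^-*-period : ∀ (f : A → A) N → (∀ x → (f ^ N) x ≡ x) → ∀ r (x : A) → (f ^ (r ℕ.* N)) x ≡ x
  ^-*-period f N period zero x = refl
  ^-*-period f N period (suc r) x =
    trans (^-+ f N (r ℕ.* N) x) (trans (period _) (^-*-period f N period r x))

  ^-+*-period : ∀ (f : A → A) N → (∀ x → (f ^ N) x ≡ x) → ∀ b r (x : A) → (f ^ (b ℕ.+ r ℕ.* N)) x ≡ (f ^ b) x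
  ^-+*-period f N period b r x = trans (^-+ f b (r ℕ.* N) x) (cong (f ^ b) (^-*-period f N period r x))

  rightInverse≡^ : ∀ (f g : A → A) K → (∀ x → (f ^ suc K) x ≡ x) → (∀ x → f (g x) ≡ x) →
                   ∀ (x : A) → g x ≡ (f ^ K) x
  rightInverse≡^ f g K period fg≡id x = begin
    g x                 ≡⟨ period (g x) ⟨
    f ((f ^ K) (g x))   ≡⟨ ^-suc′ f K (g x) ⟨
    (f ^ K) (f (g x))   ≡⟨ cong (f ^ K) (fg≡id x) ⟩
    (f ^ K) x           ∎
    where open ≡-Reasoning

  leftInverse⇒injective : ∀ (f g : A → A) → (∀ x → g (f x) ≡ x) → ∀ x y → f x ≡ f y → x ≡ y
  leftInverse⇒injective f g gf≡id x y eq = trans (sym (gf≡id x)) (trans (cong g eq) (gf≡id y))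

  ^-injective : ∀ (f : A → A) → (∀ x y → f x ≡ f y → x ≡ y) → ∀ t (x y : A) → (f ^ t) x ≡ (f ^ t) y → x ≡ y
  ^-injective f f-inj zero x y eq = eq
  ^-injective f f-inj (suc t) x y eq = ^-injective f f-inj t x y (f-inj _ _ eq)

  when : Bool → (A → A) → A → A
  when false f x = x
  when true f x = f x

  when-xor : ∀ (f : A → A) → (∀ x → f (f x) ≡ x) → ∀ b c x → when b f (when c f x) ≡ when (b xor c) f x
  when-xor f f-involutive false c x = refl
  when-xor f f-involutive true false x = refl
  when-xor f f-involutive true true x = f-involutive x

  when-injective : ∀ (f : A → A) → (∀ x y → f x ≡ f y → x ≡ y) →
                   ∀ {b c} x y → b ≡ c → when b f x ≡ when c f y → x ≡ y
  when-injective f f-injective {false} x y refl eq = eq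
  when-injective f f-injective {true} x y refl eq = f-injective x y eq

  when-commute : ∀ (f g : A → A) → (∀ x → f (g x) ≡ g (f x)) → ∀ b (x : A) → when b f (g x) ≡ g (when b f x)
  when-commute f g fg≡gf false x = refl
  when-commute f g fg≡gf true x = fg≡gf x

  when-distinguishes : ∀ (f : A → A) (x : A) → f x ≢ x → ∀ b c → when b f x ≡ when c f x → b ≡ c
  when-distinguishes f x fx≢x false false eq = refl
  when-distinguishes f x fx≢x false true eq = ⊥-elim (fx≢x (sym eq))
  when-distinguishes f x fx≢x true false eq = ⊥-elim (fx≢x eq)
  when-distinguishes f x fx≢x true true eq = refl

act-++ : ∀ {n m} (w w' : Word) (v : Tuple n m) → act (w ++ w') v ≡ act w (act w' v)
act-++ [] w' v = refl
act-++ (l ∷ w) w' v = cong (apply l) (act-++ w w' v)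

infixr 8 _^ʷ_
_^ʷ_ : Word → ℕ → Word
w ^ʷ zero = []
w ^ʷ suc t = w ++ w ^ʷ t

act-^ʷ : ∀ {n m} w t (v : Tuple n m) → act (w ^ʷ t) v ≡ (act w ^ t) v
act-^ʷ w zero v = refl
act-^ʷ w (suc t) v = trans (act-++ w (w ^ʷ t) v) (cong (act w) (act-^ʷ w t v))

whenʷ : Bool → Word → Word
whenʷ b w = if b then w else []

act-whenʷ : ∀ {n m} b w (v : Tuple n m) → act (whenʷ b w) v ≡ when b (act w) v
act-whenʷ false w v = refl
act-whenʷ true w v = refl

module ZMod (K : ℕ) where

  N : ℕ
  N = suc K

  infix 4 _≈_
  data _≈_ (a b : ℤ) : Set where
    ≈-intro : (q : ℤ) → a ≡ b ℤ.+ q ℤ.* + N → a ≈ b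

  ≈-reflexive : ∀ {a b} → a ≡ b → a ≈ b
  ≈-reflexive {a} refl = ≈-intro (+ 0) (sym (ℤP.+-identityʳ a))

  ≈-refl : ∀ {a} → a ≈ a
  ≈-refl = ≈-reflexive refl

  ≈-sym : ∀ {a b} → a ≈ b → b ≈ a
  ≈-sym {b = b} (≈-intro q refl) = ≈-intro (ℤ.- q) (ring b q (+ N))
    where
    ring : ∀ b q n → b ≡ (b ℤ.+ q ℤ.* n) ℤ.+ ℤ.- q ℤ.* n
    ring = solve-∀

  ≈-trans : ∀ {a b c} → a ≈ b → b ≈ c → a ≈ c
  ≈-trans {c = c} (≈-intro q refl) (≈-intro r refl) = ≈-intro (r ℤ.+ q) (ring c q r (+ N))
    where
    ring : ∀ c q r n → (c ℤ.+ r ℤ.* n) ℤ.+ q ℤ.* n ≡ c ℤ.+ (r ℤ.+ q) ℤ.* n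
    ring = solve-∀

  +-cong : ∀ {a a' b b'} → a ≈ a' → b ≈ b' → a ℤ.+ b ≈ a' ℤ.+ b'
  +-cong {a' = a'} {b' = b'} (≈-intro q refl) (≈-intro r refl) = ≈-intro (q ℤ.+ r) (ring a' b' q r (+ N))
    where
    ring : ∀ a b q r n → (a ℤ.+ q ℤ.* n) ℤ.+ (b ℤ.+ r ℤ.* n) ≡ (a ℤ.+ b) ℤ.+ (q ℤ.+ r) ℤ.* n
    ring = solve-∀

  +-congˡ : ∀ a {b b'} → b ≈ b' → a ℤ.+ b ≈ a ℤ.+ b'
  +-congˡ a {b} {b'} = +-cong {a} {a} {b} {b'} ≈-refl

  neg-cong : ∀ {a b} → a ≈ b → ℤ.- a ≈ ℤ.- b
  neg-cong {b = b} (≈-intro q refl) = ≈-intro (ℤ.- q) (ring b q (+ N))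
    where
    ring : ∀ b q n → ℤ.- (b ℤ.+ q ℤ.* n) ≡ ℤ.- b ℤ.+ ℤ.- q ℤ.* n
    ring = solve-∀

  pos-+-* : ∀ b r → + (b ℕ.+ r ℕ.* N) ≡ + b ℤ.+ + r ℤ.* + N
  pos-+-* b r = trans (ℤP.pos-+ b (r ℕ.* N)) (cong (ℤ._+_ (+ b)) (ℤP.pos-* r N))

  ≈⇒≡+*N : ∀ {a b} → + a ≈ + b → Σ ℕ (λ r → a ≡ b ℕ.+ r ℕ.* N) ⊎ Σ ℕ (λ r → b ≡ a ℕ.+ r ℕ.* N)
  ≈⇒≡+*N {b = b} (≈-intro (+ r) eq) = inj₁ (r , ℤP.+-injective (trans eq (sym (pos-+-* b r))))
  ≈⇒≡+*N {a} {b} (≈-intro -[1+ r ] eq) =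
    inj₂ (suc r , ℤP.+-injective (trans (trans (ring (+ b) (+ suc r) (+ N)) (cong (λ z → z ℤ.+ + suc r ℤ.* + N) (sym eq)))
                                        (sym (pos-+-* a (suc r)))))
    where
    ring : ∀ b q n → b ≡ (b ℤ.+ ℤ.- q ℤ.* n) ℤ.+ q ℤ.* n
    ring = solve-∀

  <N⇒≢+suc*N : ∀ {a b r} → a ℕ.< N → a ≢ b ℕ.+ suc r ℕ.* N
  <N⇒≢+suc*N {b = b} {r} a<N refl = ℕP.<⇒≱ a<N (ℕP.≤-trans (ℕP.m≤m+n N (r ℕ.* N)) (ℕP.m≤n+m _ b))

  ≈⇒≡ : ∀ {a b} → a ℕ.< N → b ℕ.< N → + a ≈ + b → a ≡ b
  ≈⇒≡ {a} {b} a<N b<N a≈b with ≈⇒≡+*N a≈b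
  ... | inj₁ (zero , eq) = trans eq (ℕP.+-identityʳ b)
  ... | inj₁ (suc r , eq) = ⊥-elim (<N⇒≢+suc*N {r = r} a<N eq)
  ... | inj₂ (zero , eq) = sym (trans eq (ℕP.+-identityʳ a))
  ... | inj₂ (suc r , eq) = ⊥-elim (<N⇒≢+suc*N {r = r} b<N eq)

  ≈-setoid : Setoid 0ℓ 0ℓ
  ≈-setoid = record
    { Carrier = ℤ ; _≈_ = _≈_
    ; isEquivalence = record { refl = ≈-refl ; sym = ≈-sym ; trans = ≈-trans } }

  ^-≈ : ∀ {A : Set} (f : A → A) → (∀ x → (f ^ N) x ≡ x) → ∀ {a b} x → + a ≈ + b → (f ^ a) x ≡ (f ^ b) x
  ^-≈ f period {a} {b} x a≈b with ≈⇒≡+*N a≈b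
  ... | inj₁ (r , refl) = ^-+*-period f N period b r x
  ... | inj₂ (r , refl) = sym (^-+*-period f N period a r x)

  toℤ : Fin N → ℤ
  toℤ i = + toℕ i

  toℤ-injective : ∀ {i j} → toℤ i ≈ toℤ j → i ≡ j
  toℤ-injective {i} {j} i≈j = toℕ-injective (≈⇒≡ (toℕ<n i) (toℕ<n j) i≈j)

  toℤ-mod : ∀ c → toℤ (c mod N) ≈ + c
  toℤ-mod c = ≈-sym (≈-intro (+ (c / N)) eq)
    where
    eq : + c ≡ toℤ (c mod N) ℤ.+ + (c / N) ℤ.* + N
    eq = trans (cong +_ (trans (m≡m%n+[m/n]*n c N) (cong (ℕ._+ c / N ℕ.* N) (sym (toℕ-fromℕ< (m%n<n c N))))))
               (pos-+-* _ (c / N))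

  toℤ-addℕ : ∀ c i → toℤ (addℕ c i) ≈ + c ℤ.+ toℤ i
  toℤ-addℕ c i = ≈-trans (toℤ-mod (c ℕ.+ toℕ i)) (≈-reflexive (ℤP.pos-+ c (toℕ i)))

  toℤ-dec : ∀ i → toℤ (dec i) ≈ ℤ.-1ℤ ℤ.+ toℤ i
  toℤ-dec i = ≈-trans (toℤ-addℕ K i) (≈-intro (+ 1) (ring (+ K) (toℤ i)))
    where
    ring : ∀ k x → k ℤ.+ x ≡ (ℤ.-1ℤ ℤ.+ x) ℤ.+ + 1 ℤ.* (+ 1 ℤ.+ k)
    ring = solve-∀

  toℤ-neg : ∀ i → toℤ (neg i) ≈ ℤ.- toℤ i
  toℤ-neg i = ≈-trans (toℤ-mod (N ℕ.∸ toℕ i)) (≈-intro (+ 1) eq)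
    where
    ring : ∀ n x → n ℤ.+ ℤ.- x ≡ ℤ.- x ℤ.+ + 1 ℤ.* n
    ring = solve-∀
    eq : + (N ℕ.∸ toℕ i) ≡ ℤ.- toℤ i ℤ.+ + 1 ℤ.* + N
    eq = begin
      + (N ℕ.∸ toℕ i)        ≡⟨ ℤP.⊖-≥ (toℕ≤n i) ⟨
      N ℤ.⊖ toℕ i            ≡⟨ ℤP.m-n≡m⊖n N (toℕ i) ⟨
      + N ℤ.+ ℤ.- toℤ i      ≡⟨ ring (+ N) (toℤ i) ⟩
      ℤ.- toℤ i ℤ.+ + 1 ℤ.* + N ∎
      where open ≡-Reasoning

  -- The two readings of a term agree modulo N, so an identity between terms in Fin N
  -- follows from a ring identity between their integer readings.
  infix 9 ‵_
  infixr 8 ‵-_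
  infixr 6 _‵+_
  data Expr : Set where
    ‵_    : Fin N → Expr
    _‵+_  : ℕ → Expr → Expr
    ‵-_   : Expr → Expr
    ‵dec  : Expr → Expr
    ‵inc^ : ℕ → Expr → Expr
    ‵dec^ : ℕ → Expr → Expr

  ⟦_⟧ : Expr → Fin N
  ⟦ ‵ i ⟧ = i
  ⟦ c ‵+ e ⟧ = addℕ c ⟦ e ⟧
  ⟦ ‵- e ⟧ = neg ⟦ e ⟧
  ⟦ ‵dec e ⟧ = dec ⟦ e ⟧
  ⟦ ‵inc^ t e ⟧ = (inc ^ t) ⟦ e ⟧
  ⟦ ‵dec^ t e ⟧ = (dec ^ t) ⟦ e ⟧

  ⟦_⟧ℤ : Expr → ℤ
  ⟦ ‵ i ⟧ℤ = toℤ i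
  ⟦ c ‵+ e ⟧ℤ = + c ℤ.+ ⟦ e ⟧ℤ
  ⟦ ‵- e ⟧ℤ = ℤ.- ⟦ e ⟧ℤ
  ⟦ ‵dec e ⟧ℤ = ℤ.-1ℤ ℤ.+ ⟦ e ⟧ℤ
  ⟦ ‵inc^ t e ⟧ℤ = + t ℤ.+ ⟦ e ⟧ℤ
  ⟦ ‵dec^ t e ⟧ℤ = ℤ.- (+ t) ℤ.+ ⟦ e ⟧ℤ

  ⟦⟧≈⟦⟧ℤ : ∀ e → toℤ ⟦ e ⟧ ≈ ⟦ e ⟧ℤ
  ⟦⟧≈⟦⟧ℤ (‵ i) = ≈-refl
  ⟦⟧≈⟦⟧ℤ (c ‵+ e) = ≈-trans (toℤ-addℕ c ⟦ e ⟧) (+-congˡ (+ c) (⟦⟧≈⟦⟧ℤ e))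
  ⟦⟧≈⟦⟧ℤ (‵- e) = ≈-trans (toℤ-neg ⟦ e ⟧) (neg-cong (⟦⟧≈⟦⟧ℤ e))
  ⟦⟧≈⟦⟧ℤ (‵dec e) = ≈-trans (toℤ-dec ⟦ e ⟧) (+-congˡ ℤ.-1ℤ (⟦⟧≈⟦⟧ℤ e))
  ⟦⟧≈⟦⟧ℤ (‵inc^ zero e) = ≈-trans (⟦⟧≈⟦⟧ℤ e) (≈-reflexive (sym (ℤP.+-identityˡ _)))
  ⟦⟧≈⟦⟧ℤ (‵inc^ (suc t) e) = begin
    toℤ (inc ((inc ^ t) ⟦ e ⟧))   ≈⟨ toℤ-addℕ 1 _ ⟩
    + 1 ℤ.+ toℤ ((inc ^ t) ⟦ e ⟧) ≈⟨ +-congˡ (+ 1) (⟦⟧≈⟦⟧ℤ (‵inc^ t e)) ⟩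
    + 1 ℤ.+ (+ t ℤ.+ ⟦ e ⟧ℤ)      ≡⟨ ℤP.+-assoc (+ 1) (+ t) ⟦ e ⟧ℤ ⟨
    + suc t ℤ.+ ⟦ e ⟧ℤ            ∎
    where open ≈-Reasoning ≈-setoid
  ⟦⟧≈⟦⟧ℤ (‵dec^ zero e) = ≈-trans (⟦⟧≈⟦⟧ℤ e) (≈-reflexive (sym (ℤP.+-identityˡ _)))
  ⟦⟧≈⟦⟧ℤ (‵dec^ (suc t) e) = begin
    toℤ (dec ((dec ^ t) ⟦ e ⟧))               ≈⟨ toℤ-dec _ ⟩
    ℤ.-1ℤ ℤ.+ toℤ ((dec ^ t) ⟦ e ⟧)           ≈⟨ +-congˡ ℤ.-1ℤ (⟦⟧≈⟦⟧ℤ (‵dec^ t e)) ⟩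
    ℤ.-1ℤ ℤ.+ (ℤ.- (+ t) ℤ.+ ⟦ e ⟧ℤ)          ≡⟨ ring (+ t) ⟦ e ⟧ℤ ⟩
    ℤ.- (+ 1 ℤ.+ + t) ℤ.+ ⟦ e ⟧ℤ              ∎
    where
    open ≈-Reasoning ≈-setoid
    ring : ∀ t x → ℤ.-1ℤ ℤ.+ (ℤ.- t ℤ.+ x) ≡ ℤ.- (+ 1 ℤ.+ t) ℤ.+ x
    ring = solve-∀

  ⟦⟧-≈ : ∀ e₁ e₂ → ⟦ e₁ ⟧ℤ ≈ ⟦ e₂ ⟧ℤ → ⟦ e₁ ⟧ ≡ ⟦ e₂ ⟧
  ⟦⟧-≈ e₁ e₂ e₁≈e₂ = toℤ-injective (≈-trans (⟦⟧≈⟦⟧ℤ e₁) (≈-trans e₁≈e₂ (≈-sym (⟦⟧≈⟦⟧ℤ e₂))))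

  ⟦⟧-≡ : ∀ e₁ e₂ → ⟦ e₁ ⟧ℤ ≡ ⟦ e₂ ⟧ℤ → ⟦ e₁ ⟧ ≡ ⟦ e₂ ⟧
  ⟦⟧-≡ e₁ e₂ eq = ⟦⟧-≈ e₁ e₂ (≈-reflexive eq)

  inc-dec : ∀ i → inc (dec i) ≡ i
  inc-dec i = ⟦⟧-≡ (1 ‵+ ‵dec (‵ i)) (‵ i) (ring (toℤ i))
    where
    ring : ∀ x → + 1 ℤ.+ (ℤ.-1ℤ ℤ.+ x) ≡ x
    ring = solve-∀

  dec-inc : ∀ i → dec (inc i) ≡ i
  dec-inc i = ⟦⟧-≡ (‵dec (1 ‵+ ‵ i)) (‵ i) (ring (toℤ i))
    where
    ring : ∀ x → ℤ.-1ℤ ℤ.+ (+ 1 ℤ.+ x) ≡ x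
    ring = solve-∀

  inc^N : ∀ i → (inc ^ N) i ≡ i
  inc^N i = ⟦⟧-≈ (‵inc^ N (‵ i)) (‵ i) (≈-intro (+ 1) (ring (+ N) (toℤ i)))
    where
    ring : ∀ n x → n ℤ.+ x ≡ x ℤ.+ + 1 ℤ.* n
    ring = solve-∀

  dec^N : ∀ i → (dec ^ N) i ≡ i
  dec^N i = ⟦⟧-≈ (‵dec^ N (‵ i)) (‵ i) (≈-intro ℤ.-1ℤ (ring (+ N) (toℤ i)))
    where
    ring : ∀ n x → ℤ.- n ℤ.+ x ≡ x ℤ.+ ℤ.-1ℤ ℤ.* n
    ring = solve-∀

  inc^-injective : ∀ {x y} i → x ℕ.< N → y ℕ.< N → (inc ^ x) i ≡ (inc ^ y) i → x ≡ y
  inc^-injective {x} {y} i x<N y<N eq = ≈⇒≡ x<N y<N (begin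
    + x                              ≡⟨ cancel (+ x) (toℤ i) ⟩
    ℤ.- toℤ i ℤ.+ (+ x ℤ.+ toℤ i)    ≈⟨ +-congˡ (ℤ.- toℤ i) (⟦⟧≈⟦⟧ℤ (‵inc^ x (‵ i))) ⟨
    ℤ.- toℤ i ℤ.+ toℤ ((inc ^ x) i)  ≡⟨ cong (λ j → ℤ.- toℤ i ℤ.+ toℤ j) eq ⟩
    ℤ.- toℤ i ℤ.+ toℤ ((inc ^ y) i)  ≈⟨ +-congˡ (ℤ.- toℤ i) (⟦⟧≈⟦⟧ℤ (‵inc^ y (‵ i))) ⟩
    ℤ.- toℤ i ℤ.+ (+ y ℤ.+ toℤ i)    ≡⟨ cancel (+ y) (toℤ i) ⟨
    + y                              ∎)
    where
    open ≈-Reasoning ≈-setoid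
    cancel : ∀ x a → x ≡ ℤ.- a ℤ.+ (x ℤ.+ a)
    cancel = solve-∀

record IsFaithfulAction {n m} {G : Set} (_·_ : G → G → G) (ε : G) (ρ : G → Tuple n m → Tuple n m) : Set where
  field
    ρ-ε      : ∀ v → ρ ε v ≡ v
    ρ-·      : ∀ x y v → ρ x (ρ y v) ≡ ρ (x · y) v
    faithful : ∀ x y → (∀ v → IsVertex v → ρ x v ≡ ρ y v) → x ≡ y

-- Inv is an invariant of the letters satisfied by all vertices: the generators only have to
-- act as prescribed on tuples satisfying it.
module FromFaithfulAction
  {n m} {G : Set} {_·_ : G → G → G} {ε : G} {ρ : G → Tuple n m → Tuple n m}
  (action : IsFaithfulAction _·_ ε ρ)
  (Inv : Tuple n m → Set) (vertex⇒Inv : ∀ v → IsVertex v → Inv v) (Inv-apply : ∀ l v → Inv v → Inv (apply l v))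
  (gen : Letter → G) (ρ-gen : ∀ l v → Inv v → ρ (gen l) v ≡ apply l v)
  (word : G → Word) (act-word : ∀ g v → Inv v → act (word g) v ≡ ρ g v)
  where

  open IsFaithfulAction action

  eval : Word → G
  eval [] = ε
  eval (l ∷ w) = gen l · eval w

  Inv-act : ∀ w v → Inv v → Inv (act w v)
  Inv-act [] v inv = inv
  Inv-act (l ∷ w) v inv = Inv-apply l _ (Inv-act w v inv)

  act≡ρ-eval : ∀ w v → Inv v → act w v ≡ ρ (eval w) v
  act≡ρ-eval [] v inv = sym (ρ-ε v)
  act≡ρ-eval (l ∷ w) v inv = begin
    apply l (act w v)              ≡⟨ ρ-gen l _ (Inv-act w v inv) ⟨
    ρ (gen l) (act w v)            ≡⟨ cong (ρ (gen l)) (act≡ρ-eval w v inv) ⟩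
    ρ (gen l) (ρ (eval w) v)       ≡⟨ ρ-· _ _ v ⟩
    ρ (gen l · eval w) v           ∎
    where open ≡-Reasoning

  eval-++ : ∀ w w' → eval (w ++ w') ≡ eval w · eval w'
  eval-++ w w' = faithful _ _ λ v isV → let inv = vertex⇒Inv v isV in begin
    ρ (eval (w ++ w')) v           ≡⟨ act≡ρ-eval (w ++ w') v inv ⟨
    act (w ++ w') v                ≡⟨ act-++ w w' v ⟩
    act w (act w' v)               ≡⟨ act≡ρ-eval w _ (Inv-act w' v inv) ⟩
    ρ (eval w) (act w' v)          ≡⟨ cong (ρ (eval w)) (act≡ρ-eval w' v inv) ⟩
    ρ (eval w) (ρ (eval w') v)     ≡⟨ ρ-· _ _ v ⟩
    ρ (eval w · eval w') v         ∎
    where open ≡-Reasoning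

  iso : A≅ n m G _·_
  iso = record
    { f = eval
    ; hom = eval-++
    ; wd = λ w w' same → faithful _ _ λ v isV → let inv = vertex⇒Inv v isV in
        trans (sym (act≡ρ-eval w v inv)) (trans (same v isV) (act≡ρ-eval w' v inv))
    ; inj = λ w w' eq v isV → let inv = vertex⇒Inv v isV in
        trans (act≡ρ-eval w v inv) (trans (cong (λ g → ρ g v) eq) (sym (act≡ρ-eval w' v inv)))
    ; surj = λ g → word g , faithful _ _ λ v isV → let inv = vertex⇒Inv v isV in
        trans (sym (act≡ρ-eval (word g) v inv)) (act-word g v inv)
    }

when-isFaithfulAction : ∀ {n m} (f : Tuple n m → Tuple n m) → (∀ v → f (f v) ≡ v) →
                        ∀ t → IsVertex t → f t ≢ t → IsFaithfulAction _xor_ false (λ b → when b f)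
when-isFaithfulAction f f-involutive t isV ft≢t = record
  { ρ-ε = λ v → refl
  ; ρ-· = when-xor f f-involutive
  ; faithful = λ b c agree → when-distinguishes f t ft≢t b c (agree t isV)
  }

module WithCommutingInvolution
  {n m} {G : Set} {_·_ : G → G → G} {ε : G} {ρ : G → Tuple n m → Tuple n m}
  (action : IsFaithfulAction _·_ ε ρ)
  (Z : Tuple n m → Tuple n m) (Z-involutive : ∀ v → Z (Z v) ≡ v) (Z-commute : ∀ g v → Z (ρ g v) ≡ ρ g (Z v))
  (observe : Tuple n m → Bool) (t : Tuple n m) (t-vertex : IsVertex t)
  (observe-ρ : ∀ g c → observe (ρ g (when c Z t)) ≡ c)
  where

  open IsFaithfulAction action

  ρ× : G × Bool → Tuple n m → Tuple n m
  ρ× (g , c) v = ρ g (when c Z v)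

  ρ×-· : ∀ x y v → ρ× x (ρ× y v) ≡ ρ× ((_·_ ·× _xor_) x y) v
  ρ×-· (g , c) (h , d) v = begin
    ρ g (when c Z (ρ h (when d Z v)))   ≡⟨ cong (ρ g) (when-commute Z (ρ h) (Z-commute h) c _) ⟩
    ρ g (ρ h (when c Z (when d Z v)))   ≡⟨ ρ-· g h _ ⟩
    ρ (g · h) (when c Z (when d Z v))   ≡⟨ cong (ρ (g · h)) (when-xor Z Z-involutive c d v) ⟩
    ρ (g · h) (when (c xor d) Z v)      ∎
    where open ≡-Reasoning

  ρ×-faithful : ∀ x y → (∀ v → IsVertex v → ρ× x v ≡ ρ× y v) → x ≡ y
  ρ×-faithful (g , c) (h , d) agree with trans (sym (observe-ρ g c)) (trans (cong observe (agree t t-vertex)) (observe-ρ h d))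
  ... | refl = cong (_, c) (faithful g h λ v isV →
    when-injective Z (leftInverse⇒injective Z Z Z-involutive) {c} _ _ refl
      (trans (when-commute Z (ρ g) (Z-commute g) c v) (trans (agree v isV) (sym (when-commute Z (ρ h) (Z-commute h) c v)))))

  isFaithfulAction : IsFaithfulAction (_·_ ·× _xor_) (ε , false) ρ×
  isFaithfulAction = record { ρ-ε = λ v → ρ-ε _ ; ρ-· = ρ×-· ; faithful = ρ×-faithful }

-- ρ (i , s) = Rⁱ Pˢ realises gⁱhˢ ∈ D_(suc K); the hypothesis P∘R says P R P = R⁻¹.
module DihedralAction {n m} (K : ℕ) (wR wP : Word)
  (R-period : ∀ v → (act {n} {m} wR ^ suc K) v ≡ v)
  (P-involutive : ∀ v → act {n} {m} wP (act wP v) ≡ v)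
  (P∘R : ∀ v → act {n} {m} wP (act wR v) ≡ (act wR ^ K) (act wP v))
  where

  open ZMod K

  R P : Tuple n m → Tuple n m
  R = act wR
  P = act wP

  ρ : D N → Tuple n m → Tuple n m
  ρ (i , s) v = (R ^ toℕ i) (when s P v)

  ρ-mod : ∀ c s v → ρ (c mod N , s) v ≡ (R ^ c) (when s P v)
  ρ-mod c s v = ^-≈ R R-period _ (toℤ-mod c)

  P∘R^ : ∀ j v → P ((R ^ j) v) ≡ (R ^ (j ℕ.* K)) (P v)
  P∘R^ zero v = refl
  P∘R^ (suc j) v = trans (P∘R _) (trans (cong (R ^ K) (P∘R^ j v)) (sym (^-+ R K (j ℕ.* K) (P v))))

  ρ-· : ∀ x y v → ρ x (ρ y v) ≡ ρ (x ·D y) v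
  ρ-· (i , false) (j , t) v =
    trans (sym (^-+ R (toℕ i) (toℕ j) _))
          (^-≈ R R-period _ (≈-sym (≈-trans (toℤ-addℕ (toℕ i) j) (≈-reflexive (sym (ℤP.pos-+ (toℕ i) (toℕ j)))))))
  ρ-· (i , true) (j , t) v = begin
    (R ^ toℕ i) (P ((R ^ toℕ j) (when t P v)))          ≡⟨ cong (R ^ toℕ i) (P∘R^ (toℕ j) _) ⟩
    (R ^ toℕ i) ((R ^ (toℕ j ℕ.* K)) (P (when t P v)))  ≡⟨ ^-+ R (toℕ i) (toℕ j ℕ.* K) _ ⟨
    (R ^ (toℕ i ℕ.+ toℕ j ℕ.* K)) (P (when t P v))      ≡⟨ ^-≈ R R-period _ exponent ⟩
    (R ^ toℕ (i ⊕ neg j)) (P (when t P v))              ≡⟨ cong (R ^ toℕ (i ⊕ neg j)) (when-xor P P-involutive true t v) ⟩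
    (R ^ toℕ (i ⊕ neg j)) (when (not t) P v)            ∎
    where
    open ≡-Reasoning
    ring : ∀ i j k → i ℤ.+ j ℤ.* k ≡ (i ℤ.+ ℤ.- j) ℤ.+ j ℤ.* (+ 1 ℤ.+ k)
    ring = solve-∀
    exponent : + (toℕ i ℕ.+ toℕ j ℕ.* K) ≈ toℤ (i ⊕ neg j)
    exponent = ≈-trans
      (≈-intro (toℤ j) (trans (ℤP.pos-+ (toℕ i) (toℕ j ℕ.* K))
                   (trans (cong (ℤ._+_ (toℤ i)) (ℤP.pos-* (toℕ j) K)) (ring (toℤ i) (toℤ j) (+ K)))))
      (≈-sym (≈-trans (toℤ-addℕ (toℕ i) (neg j)) (+-congˡ (toℤ i) (toℤ-neg j))))

  word : D N → Word
  word (i , s) = wR ^ʷ toℕ i ++ whenʷ s wP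

  act-word : ∀ g v → act (word g) v ≡ ρ g v
  act-word (i , s) v = begin
    act (wR ^ʷ toℕ i ++ whenʷ s wP) v      ≡⟨ act-++ (wR ^ʷ toℕ i) (whenʷ s wP) v ⟩
    act (wR ^ʷ toℕ i) (act (whenʷ s wP) v) ≡⟨ act-^ʷ wR (toℕ i) _ ⟩
    (R ^ toℕ i) (act (whenʷ s wP) v)       ≡⟨ cong (R ^ toℕ i) (act-whenʷ s wP v) ⟩
    (R ^ toℕ i) (when s P v)               ∎
    where open ≡-Reasoning

  R-injective : ∀ x y → R x ≡ R y → x ≡ y
  R-injective = leftInverse⇒injective R (R ^ K) (λ z → trans (^-suc′ R K z) (R-period z))

  isFaithfulAction : ∀ t₀ t₁ → IsVertex t₀ → IsVertex t₁ → P t₀ ≡ t₀ → P t₁ ≢ t₁ →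
                     (∀ i j → (R ^ toℕ i) t₀ ≡ (R ^ toℕ j) t₀ → i ≡ j) →
                     IsFaithfulAction _·D_ (F.zero , false) ρ
  isFaithfulAction t₀ t₁ isV₀ isV₁ Pt₀≡t₀ Pt₁≢t₁ R^-separates =
    record { ρ-ε = λ v → refl ; ρ-· = ρ-· ; faithful = faithful }
    where
    when-P-t₀ : ∀ s → when s P t₀ ≡ t₀
    when-P-t₀ false = refl
    when-P-t₀ true = Pt₀≡t₀

    faithful : ∀ x y → (∀ v → IsVertex v → ρ x v ≡ ρ y v) → x ≡ y
    faithful (i , s) (j , t) agree
      with R^-separates i j (trans (cong (R ^ toℕ i) (sym (when-P-t₀ s)))
                                   (trans (agree t₀ isV₀) (cong (R ^ toℕ j) (when-P-t₀ t))))
    ... | refl = cong (i ,_) (when-distinguishes P t₁ Pt₁≢t₁ s t (^-injective R R-injective (toℕ i) _ _ (agree t₁ isV₁)))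

tuple-≡ : ∀ {n m} {a a' : Fin n} {bs bs' : Vec Bool m} {b b' : Fin n} →
          a ≡ a' → bs ≡ bs' → b ≡ b' → (a , bs , b) ≡ (a' , bs' , b')
tuple-≡ refl refl refl = refl

map-not-involutive : ∀ {m} (bs : Vec Bool m) → map not (map not bs) ≡ bs
map-not-involutive bs = trans (sym (map-∘ not not bs)) (trans (map-cong not-involutive bs) (map-id bs))

reverse-replicate : ∀ m (x : Bool) → reverse (replicate m x) ≡ replicate m x
reverse-replicate m x = begin
  reverse (replicate m x)               ≡⟨ cong reverse (map-const (replicate m x) x) ⟨
  reverse (map (λ _ → x) (replicate m x)) ≡⟨ map-reverse (λ _ → x) (replicate m x) ⟨
  map (λ _ → x) (reverse (replicate m x)) ≡⟨ map-const _ x ⟩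
  replicate m x                         ∎
  where open ≡-Reasoning

ψ-involutive : ∀ {n m} (v : Tuple n m) → ψ (ψ v) ≡ v
ψ-involutive (a , bs , b) = tuple-≡ refl (reverse-involutive bs) refl

bits : ∀ {n m} → Tuple n m → Vec Bool m
bits (_ , bs , _) = bs

bits-when-ψ : ∀ {n m} {x : Bool} s (v : Tuple n m) → bits v ≡ replicate m x → bits (when s ψ v) ≡ replicate m x
bits-when-ψ {m = m} {x} false v eq = eq
bits-when-ψ {m = m} {x} true v eq = trans (cong reverse eq) (reverse-replicate m x)

module YokeMaps (K m : ℕ) where

  open ZMod K public

  T : Set
  T = Tuple N m

  φ^-form : ∀ t (a : Fin N) (bs : Vec Bool m) b → (φ ^ t) (a , bs , b) ≡ ((inc ^ t) a , bs , (dec ^ t) b)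
  φ^-form zero a bs b = refl
  φ^-form (suc t) a bs b = cong φ (φ^-form t a bs b)

  φ⁻¹^-form : ∀ t (a : Fin N) (bs : Vec Bool m) b → (φ⁻¹ ^ t) (a , bs , b) ≡ ((dec ^ t) a , bs , (inc ^ t) b)
  φ⁻¹^-form zero a bs b = refl
  φ⁻¹^-form (suc t) a bs b = cong φ⁻¹ (φ⁻¹^-form t a bs b)

  φ∘φ⁻¹ : ∀ (v : T) → φ (φ⁻¹ v) ≡ v
  φ∘φ⁻¹ (a , bs , b) = tuple-≡ (inc-dec a) refl (dec-inc b)

  φ⁻¹∘φ : ∀ (v : T) → φ⁻¹ (φ v) ≡ v
  φ⁻¹∘φ (a , bs , b) = tuple-≡ (dec-inc a) refl (inc-dec b)

  φ^N : ∀ (v : T) → (φ ^ N) v ≡ v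
  φ^N (a , bs , b) = trans (φ^-form N a bs b) (tuple-≡ (inc^N a) refl (dec^N b))

  φ⁻¹≡φ^K : ∀ (v : T) → φ⁻¹ v ≡ (φ ^ K) v
  φ⁻¹≡φ^K = rightInverse≡^ φ φ⁻¹ K φ^N φ∘φ⁻¹

  ψ∘φ : ∀ (v : T) → ψ (φ v) ≡ (φ ^ K) (ψ v)
  ψ∘φ v = φ⁻¹≡φ^K (ψ v)

  bits-φ^ : ∀ t (v : T) → bits ((φ ^ t) v) ≡ bits v
  bits-φ^ t (a , bs , b) = cong bits (φ^-form t a bs b)

  φ^-injective : ∀ {x y} (v : T) → x ℕ.< N → y ℕ.< N → (φ ^ x) v ≡ (φ ^ y) v → x ≡ y
  φ^-injective {x} {y} (a , bs , b) x<N y<N eq = inc^-injective a x<N y<N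
    (cong proj₁ (trans (sym (φ^-form x a bs b)) (trans eq (φ^-form y a bs b))))

  φ^-separates : ∀ (v : T) (i j : Fin N) → (φ ^ toℕ i) v ≡ (φ ^ toℕ j) v → i ≡ j
  φ^-separates v i j = toℕ-injective ∘ φ^-injective v (toℕ<n i) (toℕ<n j)

  module Ξ (k : ℕ) where

    Ξ-word : Word
    Ξ-word = (`φ⁻¹ ∷ []) ^ʷ k ++ `τ ∷ `ψ ∷ []

    Ξ : T → T
    Ξ = act Ξ-word

    Ξ-unfold : ∀ v → Ξ v ≡ (φ⁻¹ ^ k) (τ (ψ v))
    Ξ-unfold v = trans (act-++ ((`φ⁻¹ ∷ []) ^ʷ k) (`τ ∷ `ψ ∷ []) v) (act-^ʷ (`φ⁻¹ ∷ []) k _)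

    Ξ-form : ∀ a bs c → Ξ (a , bs , c) ≡ ((dec ^ k) (neg c) , map not (reverse bs) , (inc ^ k) (neg (addℕ m a)))
    Ξ-form a bs c = trans (Ξ-unfold _) (φ⁻¹^-form k (neg c) (map not (reverse bs)) (neg (addℕ m a)))

    bits-Ξ : ∀ v → bits (Ξ v) ≡ map not (reverse (bits v))
    bits-Ξ (a , bs , c) = cong bits (Ξ-form a bs c)

    τ≡φ^k∘Ξ∘ψ : ∀ v → τ v ≡ (φ ^ k) (Ξ (ψ v))
    τ≡φ^k∘Ξ∘ψ v = sym (begin
      (φ ^ k) (Ξ (ψ v))                   ≡⟨ cong (φ ^ k) (Ξ-unfold (ψ v)) ⟩
      (φ ^ k) ((φ⁻¹ ^ k) (τ (ψ (ψ v))))   ≡⟨ cong (λ u → (φ ^ k) ((φ⁻¹ ^ k) (τ u))) (ψ-involutive v) ⟩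
      (φ ^ k) ((φ⁻¹ ^ k) (τ v))           ≡⟨ ^-cancel φ⁻¹ φ φ∘φ⁻¹ k (τ v) ⟩
      τ v                                 ∎)
      where open ≡-Reasoning

    Ξ∘φ : ∀ v → Ξ (φ v) ≡ φ (Ξ v)
    Ξ∘φ (a , bs , c) = begin
      Ξ (inc a , bs , dec c)                                                   ≡⟨ Ξ-form (inc a) bs (dec c) ⟩
      ((dec ^ k) (neg (dec c)) , _ , (inc ^ k) (neg (addℕ m (inc a))))         ≡⟨ tuple-≡ first refl third ⟩
      (inc ((dec ^ k) (neg c)) , _ , dec ((inc ^ k) (neg (addℕ m a))))         ≡⟨ cong φ (Ξ-form a bs c) ⟨
      φ (Ξ (a , bs , c))                                                       ∎
      where
      open ≡-Reasoning
      ring₁ : ∀ k c → ℤ.- k ℤ.+ ℤ.- (ℤ.-1ℤ ℤ.+ c) ≡ + 1 ℤ.+ (ℤ.- k ℤ.+ ℤ.- c)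
      ring₁ = solve-∀
      ring₃ : ∀ k m a → k ℤ.+ ℤ.- (m ℤ.+ (+ 1 ℤ.+ a)) ≡ ℤ.-1ℤ ℤ.+ (k ℤ.+ ℤ.- (m ℤ.+ a))
      ring₃ = solve-∀
      first : (dec ^ k) (neg (dec c)) ≡ inc ((dec ^ k) (neg c))
      first = ⟦⟧-≡ (‵dec^ k (‵- ‵dec (‵ c))) (1 ‵+ ‵dec^ k (‵- ‵ c)) (ring₁ (+ k) (toℤ c))
      third : (inc ^ k) (neg (addℕ m (inc a))) ≡ dec ((inc ^ k) (neg (addℕ m a)))
      third = ⟦⟧-≡ (‵inc^ k (‵- (m ‵+ 1 ‵+ ‵ a))) (‵dec (‵inc^ k (‵- (m ‵+ ‵ a)))) (ring₃ (+ k) (+ m) (toℤ a))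

    Ξ∘φ⁻¹ : ∀ v → Ξ (φ⁻¹ v) ≡ φ⁻¹ (Ξ v)
    Ξ∘φ⁻¹ v = begin
      Ξ (φ⁻¹ v)             ≡⟨ φ⁻¹∘φ _ ⟨
      φ⁻¹ (φ (Ξ (φ⁻¹ v)))   ≡⟨ cong φ⁻¹ (Ξ∘φ (φ⁻¹ v)) ⟨
      φ⁻¹ (Ξ (φ (φ⁻¹ v)))   ≡⟨ cong (λ u → φ⁻¹ (Ξ u)) (φ∘φ⁻¹ v) ⟩
      φ⁻¹ (Ξ v)             ∎
      where open ≡-Reasoning

    module _ (d : ℕ) (m≈d+2k : + m ≈ + d ℤ.+ (+ k ℤ.+ + k)) where

      shift : Fin N → Fin N
      shift a = (inc ^ d) ((inc ^ k) ((inc ^ k) a))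

      ‵shift : Expr → Expr
      ‵shift e = ‵inc^ d (‵inc^ k (‵inc^ k e))

      addℕ-m≡shift : ∀ a → addℕ m a ≡ shift a
      addℕ-m≡shift a = ⟦⟧-≈ (m ‵+ ‵ a) (‵shift (‵ a)) (begin
        + m ℤ.+ toℤ a                           ≈⟨ +-cong m≈d+2k (≈-refl {toℤ a}) ⟩
        (+ d ℤ.+ (+ k ℤ.+ + k)) ℤ.+ toℤ a       ≡⟨ ring (+ d) (+ k) (toℤ a) ⟩
        + d ℤ.+ (+ k ℤ.+ (+ k ℤ.+ toℤ a))       ∎)
        where
        open ≈-Reasoning ≈-setoid
        ring : ∀ d k a → (d ℤ.+ (k ℤ.+ k)) ℤ.+ a ≡ d ℤ.+ (k ℤ.+ (k ℤ.+ a))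
        ring = solve-∀

      Ξ-form′ : ∀ a bs c → Ξ (a , bs , c) ≡ ((dec ^ k) (neg c) , map not (reverse bs) , (inc ^ k) (neg (shift a)))
      Ξ-form′ a bs c = trans (Ξ-form a bs c) (cong (λ x → (_ , _ , (inc ^ k) (neg x))) (addℕ-m≡shift a))

      Ξ∘Ξ : ∀ v → Ξ (Ξ v) ≡ (φ ^ d) v
      Ξ∘Ξ (a , bs , c) = begin
        Ξ (Ξ (a , bs , c))                                     ≡⟨ cong Ξ (Ξ-form′ a bs c) ⟩
        Ξ ((dec ^ k) (neg c) , _ , (inc ^ k) (neg (shift a)))  ≡⟨ Ξ-form′ _ _ _ ⟩
        (_ , map not (reverse (map not (reverse bs))) , _)     ≡⟨ tuple-≡ first middle third ⟩
        ((inc ^ d) a , bs , (dec ^ d) c)                       ≡⟨ φ^-form d a bs c ⟨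
        (φ ^ d) (a , bs , c)                                   ∎
        where
        open ≡-Reasoning
        ring₁ : ∀ d k a → ℤ.- k ℤ.+ ℤ.- (k ℤ.+ ℤ.- (d ℤ.+ (k ℤ.+ (k ℤ.+ a)))) ≡ d ℤ.+ a
        ring₁ = solve-∀
        ring₃ : ∀ d k c → k ℤ.+ ℤ.- (d ℤ.+ (k ℤ.+ (k ℤ.+ (ℤ.- k ℤ.+ ℤ.- c)))) ≡ ℤ.- d ℤ.+ c
        ring₃ = solve-∀
        first : (dec ^ k) (neg ((inc ^ k) (neg (shift a)))) ≡ (inc ^ d) a
        first = ⟦⟧-≡ (‵dec^ k (‵- ‵inc^ k (‵- ‵shift (‵ a)))) (‵inc^ d (‵ a)) (ring₁ (+ d) (+ k) (toℤ a))
        middle : map not (reverse (map not (reverse bs))) ≡ bs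
        middle = begin
          map not (reverse (map not (reverse bs)))  ≡⟨ map-reverse not (map not (reverse bs)) ⟩
          reverse (map not (map not (reverse bs)))  ≡⟨ cong reverse (map-not-involutive (reverse bs)) ⟩
          reverse (reverse bs)                      ≡⟨ reverse-involutive bs ⟩
          bs                                        ∎
        third : (inc ^ k) (neg (shift ((dec ^ k) (neg c)))) ≡ (dec ^ d) c
        third = ⟦⟧-≡ (‵inc^ k (‵- ‵shift (‵dec^ k (‵- ‵ c)))) (‵dec^ d (‵ c)) (ring₃ (+ d) (+ k) (toℤ c))

      ψ∘Ξ : ∀ v → ψ (Ξ v) ≡ (φ⁻¹ ^ d) (Ξ (ψ v))
      ψ∘Ξ (a , bs , c) = begin
        ψ (Ξ (a , bs , c))                                               ≡⟨ cong ψ (Ξ-form′ a bs c) ⟩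
        ((inc ^ k) (neg (shift a)) , reverse (map not (reverse bs)) , (dec ^ k) (neg c))
                                                                         ≡⟨ tuple-≡ first middle third ⟩
        ((dec ^ d) ((dec ^ k) (neg a)) , map not (reverse (reverse bs)) , (inc ^ d) ((inc ^ k) (neg (shift c))))
                                                                         ≡⟨ φ⁻¹^-form d _ _ _ ⟨
        (φ⁻¹ ^ d) ((dec ^ k) (neg a) , _ , (inc ^ k) (neg (shift c)))    ≡⟨ cong (φ⁻¹ ^ d) (Ξ-form′ c (reverse bs) a) ⟨
        (φ⁻¹ ^ d) (Ξ (c , reverse bs , a))                               ∎
        where
        open ≡-Reasoning
        ring₁ : ∀ d k a → k ℤ.+ ℤ.- (d ℤ.+ (k ℤ.+ (k ℤ.+ a))) ≡ ℤ.- d ℤ.+ (ℤ.- k ℤ.+ ℤ.- a)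
        ring₁ = solve-∀
        ring₃ : ∀ d k c → ℤ.- k ℤ.+ ℤ.- c ≡ d ℤ.+ (k ℤ.+ ℤ.- (d ℤ.+ (k ℤ.+ (k ℤ.+ c))))
        ring₃ = solve-∀
        first : (inc ^ k) (neg (shift a)) ≡ (dec ^ d) ((dec ^ k) (neg a))
        first = ⟦⟧-≡ (‵inc^ k (‵- ‵shift (‵ a))) (‵dec^ d (‵dec^ k (‵- ‵ a))) (ring₁ (+ d) (+ k) (toℤ a))
        middle : reverse (map not (reverse bs)) ≡ map not (reverse (reverse bs))
        middle = begin
          reverse (map not (reverse bs))  ≡⟨ cong reverse (map-reverse not bs) ⟩
          reverse (reverse (map not bs))  ≡⟨ reverse-involutive (map not bs) ⟩
          map not bs                      ≡⟨ cong (map not) (reverse-involutive bs) ⟨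
          map not (reverse (reverse bs))  ∎
        third : (dec ^ k) (neg c) ≡ (inc ^ d) ((inc ^ k) (neg (shift c)))
        third = ⟦⟧-≡ (‵dec^ k (‵- ‵ c)) (‵inc^ d (‵inc^ k (‵- ‵shift (‵ c)))) (ring₃ (+ d) (+ k) (toℤ c))

headBit : ∀ {n m} → Tuple n (suc m) → Bool
headBit v = Vec.head (bits v)

sumBits-replicate-false : ∀ m → sumBits (replicate m false) ≡ 0
sumBits-replicate-false zero = refl
sumBits-replicate-false (suc m) = sumBits-replicate-false m

Fin1-unique : ∀ (a b : Fin 1) → a ≡ b
Fin1-unique F.zero F.zero = refl

module OneBucket (m : ℕ) where

  T : Set
  T = Tuple 1 m

  isVertex : ∀ (v : T) → IsVertex v
  isVertex (a , bs , b) = divides (toℕ a ℕ.+ sumBits bs ℕ.+ toℕ b) (sym (ℕP.*-identityʳ _))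

  φ-trivial : ∀ (v : T) → v ≡ φ v
  φ-trivial (a , bs , b) = tuple-≡ (Fin1-unique _ _) refl (Fin1-unique _ _)

  φ⁻¹-trivial : ∀ (v : T) → v ≡ φ⁻¹ v
  φ⁻¹-trivial (a , bs , b) = tuple-≡ (Fin1-unique _ _) refl (Fin1-unique _ _)

  τ-involutive : ∀ (v : T) → τ (τ v) ≡ v
  τ-involutive (a , bs , b) = tuple-≡ (Fin1-unique _ _) (map-not-involutive bs) (Fin1-unique _ _)

  τ∘ψ : ∀ (v : T) → τ (ψ v) ≡ ψ (τ v)
  τ∘ψ (a , bs , b) = tuple-≡ (Fin1-unique _ _) (map-reverse not bs) (Fin1-unique _ _)

  all-false : T
  all-false = (F.zero , replicate m false , F.zero)

A₁₀-trivial : (w : Word) → SameIn 1 0 w []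
A₁₀-trivial w v _ = tuple-1-0-unique (act w v) v
  where
  tuple-1-0-unique : ∀ (u v : Tuple 1 0) → u ≡ v
  tuple-1-0-unique (a , [] , b) (a' , [] , b') = tuple-≡ (Fin1-unique a a') refl (Fin1-unique b b')

A₁₁≅C₂ : A≅ 1 1 C₂ _·C₂_
A₁₁≅C₂ = FromFaithfulAction.iso
  (when-isFaithfulAction τ τ-involutive all-false (isVertex all-false) λ eq → not-¬ refl (cong headBit eq))
  (λ _ → ⊤) _ _ gen ρ-gen (λ b → whenʷ b (`τ ∷ [])) (λ b v _ → act-whenʷ b (`τ ∷ []) v)
  where
  open OneBucket 1

  gen : Letter → C₂
  gen `τ = true
  gen _ = false

  ρ-gen : ∀ l v → ⊤ → when (gen l) τ v ≡ apply l v
  ρ-gen `φ v _ = φ-trivial v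
  ρ-gen `φ⁻¹ v _ = φ⁻¹-trivial v
  ρ-gen `ψ (a , x ∷ [] , b) _ = tuple-≡ (Fin1-unique _ _) refl (Fin1-unique _ _)
  ρ-gen `τ v _ = refl

A₁ₘ≅C₂×C₂ : (m : ℕ) → 1 < m → A≅ 1 m (C₂ × C₂) (_·C₂_ ·× _·C₂_)
A₁ₘ≅C₂×C₂ (suc zero) (s≤s ())
A₁ₘ≅C₂×C₂ (suc (suc m)) _ = FromFaithfulAction.iso
  (WithCommutingInvolution.isFaithfulAction ψ-action τ τ-involutive τ-commute headBit all-false (isVertex all-false) observe)
  (λ _ → ⊤) _ _ gen ρ-gen word act-word
  where
  open OneBucket (suc (suc m))

  leading-true : T
  leading-true = (F.zero , true ∷ replicate (suc m) false , F.zero)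

  ψ-moves-leading-true : ψ leading-true ≢ leading-true
  ψ-moves-leading-true eq = not-¬ refl (trans (sym (cong headBit eq)) last-bit)
    where
    last-bit : headBit (ψ leading-true) ≡ false
    last-bit = cong Vec.head (trans (reverse-∷ true (replicate (suc m) false))
                                    (cong (Vec._∷ʳ true) (reverse-replicate (suc m) false)))

  ψ-action : IsFaithfulAction _xor_ false (λ b → when b ψ)
  ψ-action = when-isFaithfulAction ψ ψ-involutive leading-true (isVertex leading-true) ψ-moves-leading-true

  τ-commute : ∀ g v → τ (when g ψ v) ≡ when g ψ (τ v)
  τ-commute g v = sym (when-commute ψ τ (λ u → sym (τ∘ψ u)) g v)

  observe : ∀ g c → headBit (when g ψ (when c τ all-false)) ≡ c
  observe g false = cong Vec.head (bits-when-ψ g all-false refl)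
  observe g true = cong Vec.head (bits-when-ψ g (τ all-false) (map-replicate not false (suc (suc m))))

  gen : Letter → C₂ × C₂
  gen `ψ = true , false
  gen `τ = false , true
  gen _ = false , false

  ρ-gen : ∀ l v → ⊤ → when (proj₁ (gen l)) ψ (when (proj₂ (gen l)) τ v) ≡ apply l v
  ρ-gen `φ v _ = φ-trivial v
  ρ-gen `φ⁻¹ v _ = φ⁻¹-trivial v
  ρ-gen `ψ v _ = refl
  ρ-gen `τ v _ = refl

  word : C₂ × C₂ → Word
  word (g , c) = whenʷ g (`ψ ∷ []) ++ whenʷ c (`τ ∷ [])

  act-word : ∀ x v → ⊤ → act (word x) v ≡ when (proj₁ x) ψ (when (proj₂ x) τ v)
  act-word (g , c) v _ = trans (act-++ (whenʷ g (`ψ ∷ [])) _ v)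
                               (trans (act-whenʷ g (`ψ ∷ []) _) (cong (when g ψ) (act-whenʷ c (`τ ∷ []) v)))

module NoBits (K : ℕ) where

  open YokeMaps K 0

  Balanced : T → Set
  Balanced (a , _ , b) = b ≡ neg a

  vertex⇒Balanced : ∀ v → IsVertex v → Balanced v
  vertex⇒Balanced (a , [] , b) (divides q eq) = toℤ-injective (≈-trans (≈-intro (+ q) b≡) (≈-sym (toℤ-neg a)))
    where
    open ≡-Reasoning
    ring : ∀ A B → B ≡ ℤ.- A ℤ.+ (A ℤ.+ B)
    ring = solve-∀
    sum≡q*N : toℕ a ℕ.+ toℕ b ≡ q ℕ.* N
    sum≡q*N = trans (cong (ℕ._+ toℕ b) (sym (ℕP.+-identityʳ (toℕ a)))) eq
    b≡ : toℤ b ≡ ℤ.- toℤ a ℤ.+ + q ℤ.* + N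
    b≡ = begin
      toℤ b                                     ≡⟨ ring (toℤ a) (toℤ b) ⟩
      ℤ.- toℤ a ℤ.+ (toℤ a ℤ.+ toℤ b)           ≡⟨ cong (ℤ._+_ (ℤ.- toℤ a)) (ℤP.pos-+ (toℕ a) (toℕ b)) ⟨
      ℤ.- toℤ a ℤ.+ + (toℕ a ℕ.+ toℕ b)         ≡⟨ cong (λ x → ℤ.- toℤ a ℤ.+ + x) sum≡q*N ⟩
      ℤ.- toℤ a ℤ.+ + (q ℕ.* N)                 ≡⟨ cong (ℤ._+_ (ℤ.- toℤ a)) (ℤP.pos-* q N) ⟩
      ℤ.- toℤ a ℤ.+ + q ℤ.* + N                 ∎

  Balanced-apply : ∀ l v → Balanced v → Balanced (apply l v)
  Balanced-apply `φ (a , [] , b) refl = ⟦⟧-≡ (‵dec (‵- ‵ a)) (‵- (1 ‵+ ‵ a)) (ring (toℤ a))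
    where
    ring : ∀ a → ℤ.-1ℤ ℤ.+ ℤ.- a ≡ ℤ.- (+ 1 ℤ.+ a)
    ring = solve-∀
  Balanced-apply `φ⁻¹ (a , [] , b) refl = ⟦⟧-≡ (1 ‵+ ‵- ‵ a) (‵- ‵dec (‵ a)) (ring (toℤ a))
    where
    ring : ∀ a → + 1 ℤ.+ ℤ.- a ≡ ℤ.- (ℤ.-1ℤ ℤ.+ a)
    ring = solve-∀
  Balanced-apply `ψ (a , [] , b) refl = ⟦⟧-≡ (‵ a) (‵- ‵- ‵ a) (ring (toℤ a))
    where
    ring : ∀ a → a ≡ ℤ.- (ℤ.- a)
    ring = solve-∀
  Balanced-apply `τ (a , [] , b) refl = ⟦⟧-≡ (‵- (0 ‵+ ‵- ‵ a)) (‵- ‵- ‵ a) (ring (toℤ a))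
    where
    ring : ∀ a → ℤ.- (+ 0 ℤ.+ ℤ.- a) ≡ ℤ.- (ℤ.- a)
    ring = solve-∀

  ψ≡τ : ∀ v → Balanced v → ψ v ≡ τ v
  ψ≡τ (a , [] , b) refl = tuple-≡ refl refl (⟦⟧-≡ (‵ a) (‵- (0 ‵+ ‵- ‵ a)) (ring (toℤ a)))
    where
    ring : ∀ a → a ≡ ℤ.- (+ 0 ℤ.+ ℤ.- a)
    ring = solve-∀

  iso : ∀ {G : Set} {_·_ : G → G → G} {ε : G} {ρ : G → T → T} → IsFaithfulAction _·_ ε ρ →
        (gen : Letter → G) → (∀ l v → Balanced v → ρ (gen l) v ≡ apply l v) →
        (word : G → Word) → (∀ g v → act (word g) v ≡ ρ g v) → A≅ N 0 G _·_
  iso action gen ρ-gen word act-word =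
    FromFaithfulAction.iso action Balanced vertex⇒Balanced Balanced-apply gen ρ-gen word (λ g v _ → act-word g v)

A₂₀≅C₂ : A≅ 2 0 C₂ _·C₂_
A₂₀≅C₂ = iso (when-isFaithfulAction φ φ^N origin (divides 0 refl) λ ()) gen ρ-gen
             (λ b → whenʷ b (`φ ∷ [])) (λ b v → act-whenʷ b (`φ ∷ []) v)
  where
  open YokeMaps 1 0
  open NoBits 1

  origin : T
  origin = (F.zero , [] , F.zero)

  ψ-trivial : ∀ v → Balanced v → v ≡ ψ v
  ψ-trivial (F.zero , [] , _) refl = refl
  ψ-trivial (F.suc F.zero , [] , _) refl = refl

  gen : Letter → C₂
  gen `φ = true
  gen `φ⁻¹ = true
  gen _ = false

  ρ-gen : ∀ l v → Balanced v → when (gen l) φ v ≡ apply l v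
  ρ-gen `φ v _ = refl
  ρ-gen `φ⁻¹ v _ = sym (φ⁻¹≡φ^K v)
  ρ-gen `ψ v bal = ψ-trivial v bal
  ρ-gen `τ v bal = trans (ψ-trivial v bal) (ψ≡τ v bal)

Aₙ₀≅Dₙ : (n : ℕ) → 2 < n → A≅ n 0 (D n) _·D_
Aₙ₀≅Dₙ (suc zero) (s≤s ())
Aₙ₀≅Dₙ (suc (suc zero)) (s≤s (s≤s ()))
Aₙ₀≅Dₙ (suc (suc (suc k))) _ =
  iso (isFaithfulAction origin t₁ (divides 0 refl) (divides 1 t₁-sum) refl (λ ()) (φ^-separates origin))
      gen ρ-gen word act-word
  where
  open YokeMaps (suc (suc k)) 0
  open NoBits (suc (suc k))
  open DihedralAction (suc (suc k)) (`φ ∷ []) (`ψ ∷ []) φ^N ψ-involutive ψ∘φ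

  origin t₁ : T
  origin = (F.zero , [] , F.zero)
  t₁ = (F.suc F.zero , [] , F.fromℕ (suc (suc k)))

  t₁-sum : 1 ℕ.+ 0 ℕ.+ toℕ (F.fromℕ (suc (suc k))) ≡ 1 ℕ.* N
  t₁-sum = trans (cong suc (toℕ-fromℕ (suc (suc k)))) (sym (ℕP.*-identityˡ N))

  gen : Letter → D N
  gen `φ = 1 mod N , false
  gen `φ⁻¹ = suc (suc k) mod N , false
  gen `ψ = 0 mod N , true
  gen `τ = 0 mod N , true

  ρ-gen : ∀ l v → Balanced v → ρ (gen l) v ≡ apply l v
  ρ-gen `φ v _ = ρ-mod 1 false v
  ρ-gen `φ⁻¹ v _ = trans (ρ-mod (suc (suc k)) false v) (sym (φ⁻¹≡φ^K v))
  ρ-gen `ψ v _ = ρ-mod 0 true v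
  ρ-gen `τ v bal = trans (ρ-mod 0 true v) (ψ≡τ v bal)

module Separators (K m′ : ℕ) where

  open YokeMaps (suc K) (suc m′) public

  all-false t₁ : T
  all-false = (F.zero , replicate (suc m′) false , F.zero)
  t₁ = (F.zero , true ∷ replicate m′ false , F.fromℕ (suc K))

  all-false-isVertex : IsVertex all-false
  all-false-isVertex = divides 0 (trans (ℕP.+-identityʳ _) (sumBits-replicate-false (suc m′)))

  t₁-isVertex : IsVertex t₁
  t₁-isVertex = divides 1 (trans (cong suc (cong₂ ℕ._+_ (sumBits-replicate-false m′) (toℕ-fromℕ (suc K))))
                                 (sym (ℕP.*-identityˡ N)))

  ψ-fixes-all-false : ψ all-false ≡ all-false
  ψ-fixes-all-false = tuple-≡ refl (reverse-replicate (suc m′) false) refl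

  ψ-moves-t₁ : ψ t₁ ≢ t₁
  ψ-moves-t₁ ()

  module _ (k : ℕ) where
    open Ξ k

    bits-when-Ξ : ∀ c v → bits v ≡ replicate (suc m′) false → bits (when c Ξ v) ≡ replicate (suc m′) c
    bits-when-Ξ false v eq = eq
    bits-when-Ξ true v eq = trans (bits-Ξ v)
      (trans (cong (map not ∘ reverse) eq)
             (trans (cong (map not) (reverse-replicate (suc m′) false)) (map-replicate not false (suc m′))))

module EvenCase (K m′ h : ℕ) (m≡h*2 : suc m′ ≡ h ℕ.* 2) where

  open Separators K m′
  open Ξ h
  open DihedralAction (suc K) (`φ ∷ []) (`ψ ∷ []) φ^N ψ-involutive ψ∘φ

  m≈0+2h : + suc m′ ≈ + 0 ℤ.+ (+ h ℤ.+ + h)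
  m≈0+2h = ≈-reflexive (trans (cong +_ m≡h*2) (trans (ℤP.pos-* h 2) (ring (+ h))))
    where
    ring : ∀ h → h ℤ.* + 2 ≡ + 0 ℤ.+ (h ℤ.+ h)
    ring = solve-∀

  Ξ-involutive : ∀ v → Ξ (Ξ v) ≡ v
  Ξ-involutive = Ξ∘Ξ 0 m≈0+2h

  Ξ-commute : ∀ g v → Ξ (ρ g v) ≡ ρ g (Ξ v)
  Ξ-commute (i , s) v = begin
    Ξ ((φ ^ toℕ i) (when s ψ v))   ≡⟨ ^-commute Ξ φ (λ u → sym (Ξ∘φ u)) (toℕ i) _ ⟨
    (φ ^ toℕ i) (Ξ (when s ψ v))   ≡⟨ cong (φ ^ toℕ i) (when-commute ψ Ξ (ψ∘Ξ 0 m≈0+2h) s v) ⟨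
    (φ ^ toℕ i) (when s ψ (Ξ v))   ∎
    where open ≡-Reasoning

  observe : ∀ g c → headBit (ρ g (when c Ξ all-false)) ≡ c
  observe (i , s) c = cong Vec.head (trans (bits-φ^ (toℕ i) _) (bits-when-ψ s _ (bits-when-Ξ h c all-false refl)))

  module Product = WithCommutingInvolution
    (isFaithfulAction all-false t₁ all-false-isVertex t₁-isVertex ψ-fixes-all-false ψ-moves-t₁
                      (φ^-separates all-false))
    Ξ Ξ-involutive Ξ-commute headBit all-false all-false-isVertex observe

  gen : Letter → D N × C₂
  gen `φ = (1 mod N , false) , false
  gen `φ⁻¹ = (suc K mod N , false) , false
  gen `ψ = (0 mod N , true) , false
  gen `τ = (h mod N , true) , true

  ρ-gen : ∀ l v → ⊤ → Product.ρ× (gen l) v ≡ apply l v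
  ρ-gen `φ v _ = ρ-mod 1 false v
  ρ-gen `φ⁻¹ v _ = trans (ρ-mod (suc K) false v) (sym (φ⁻¹≡φ^K v))
  ρ-gen `ψ v _ = ρ-mod 0 true v
  ρ-gen `τ v _ = begin
    ρ (h mod N , true) (Ξ v)   ≡⟨ ρ-mod h true (Ξ v) ⟩
    (φ ^ h) (ψ (Ξ v))          ≡⟨ cong (φ ^ h) (ψ∘Ξ 0 m≈0+2h v) ⟩
    (φ ^ h) (Ξ (ψ v))          ≡⟨ τ≡φ^k∘Ξ∘ψ v ⟨
    τ v                        ∎
    where open ≡-Reasoning

  word× : D N × C₂ → Word
  word× (g , c) = word g ++ whenʷ c Ξ-word

  act-word× : ∀ x v → ⊤ → act (word× x) v ≡ Product.ρ× x v
  act-word× (g , c) v _ = trans (act-++ (word g) (whenʷ c Ξ-word) v)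
                                (trans (act-word g _) (cong (ρ g) (act-whenʷ c Ξ-word v)))

  iso : A≅ N (suc m′) (D N × C₂) (_·D_ ·× _·C₂_)
  iso = FromFaithfulAction.iso Product.isFaithfulAction (λ _ → ⊤) _ _ gen ρ-gen word× act-word×

isOdd : ℕ → Bool
isOdd zero = false
isOdd (suc zero) = true
isOdd (suc (suc n)) = isOdd n

n≡isOdd+⌊n/2⌋*2 : ∀ n → n ≡ bit (isOdd n) ℕ.+ ⌊ n /2⌋ ℕ.* 2
n≡isOdd+⌊n/2⌋*2 zero = refl
n≡isOdd+⌊n/2⌋*2 (suc zero) = refl
n≡isOdd+⌊n/2⌋*2 (suc (suc n)) = trans (cong (suc ∘ suc) (n≡isOdd+⌊n/2⌋*2 n))
  (sym (trans (ℕP.+-suc (bit (isOdd n)) _) (cong suc (ℕP.+-suc (bit (isOdd n)) _))))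

⌊n/2⌋< : ∀ {n t} → n ℕ.< t ℕ.* 2 → ⌊ n /2⌋ ℕ.< t
⌊n/2⌋< {n} {t} n<t*2 = ℕP.*-cancelʳ-< 2 ⌊ n /2⌋ t (ℕP.≤-<-trans ⌊n/2⌋*2≤n n<t*2)
  where
  ⌊n/2⌋*2≤n : ⌊ n /2⌋ ℕ.* 2 ℕ.≤ n
  ⌊n/2⌋*2≤n = subst (⌊ n /2⌋ ℕ.* 2 ℕ.≤_) (sym (n≡isOdd+⌊n/2⌋*2 n)) (ℕP.m≤n+m _ (bit (isOdd n)))

module OddCase (K m′ k : ℕ) (m≈1+2k : ZMod._≈_ (suc K) (+ suc m′) (+ 1 ℤ.+ (+ k ℤ.+ + k))) where

  open Separators K m′
  open Ξ k

  Ξ² : ∀ v → Ξ (Ξ v) ≡ φ v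
  Ξ² = Ξ∘Ξ 1 m≈1+2k

  Ξ^2t : ∀ t v → (Ξ ^ (t ℕ.* 2)) v ≡ (φ ^ t) v
  Ξ^2t zero v = refl
  Ξ^2t (suc t) v = trans (Ξ² _) (cong φ (Ξ^2t t v))

  Ξ-period : ∀ v → (Ξ ^ (2 ℕ.* N)) v ≡ v
  Ξ-period v = trans (cong (λ e → (Ξ ^ e) v) (ℕP.*-comm 2 N)) (trans (Ξ^2t N v) (φ^N v))

  Ξ∘φ⁻¹∘Ξ : ∀ v → Ξ (φ⁻¹ (Ξ v)) ≡ v
  Ξ∘φ⁻¹∘Ξ v = trans (Ξ∘φ⁻¹ (Ξ v)) (trans (cong φ⁻¹ (Ξ² v)) (φ⁻¹∘φ v))

  ψ∘Ξ≡Ξ⁻¹∘ψ : ∀ v → ψ (Ξ v) ≡ (Ξ ^ ℕ.pred (2 ℕ.* N)) (ψ v)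
  ψ∘Ξ≡Ξ⁻¹∘ψ v = trans (ψ∘Ξ 1 m≈1+2k v) (rightInverse≡^ Ξ (φ⁻¹ ∘ Ξ) (ℕ.pred (2 ℕ.* N)) Ξ-period Ξ∘φ⁻¹∘Ξ (ψ v))

  -- Ξ is a square root of φ, so Ξˣ = Ξ^(x mod 2) φ^⌊x/2⌋: the head bit reads off the parity
  -- of x and the first bucket then reads off ⌊x/2⌋.
  Ξ^-parity : ∀ x v → (Ξ ^ x) v ≡ when (isOdd x) Ξ ((φ ^ ⌊ x /2⌋) v)
  Ξ^-parity zero v = refl
  Ξ^-parity (suc zero) v = refl
  Ξ^-parity (suc (suc x)) v =
    trans (Ξ² _) (trans (cong φ (Ξ^-parity x v)) (sym (when-commute Ξ φ Ξ∘φ (isOdd x) _)))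

  Ξ-injective : ∀ u u' → Ξ u ≡ Ξ u' → u ≡ u'
  Ξ-injective = leftInverse⇒injective Ξ (φ⁻¹ ∘ Ξ) (λ u → trans (cong φ⁻¹ (Ξ² u)) (φ⁻¹∘φ u))

  headBit-Ξ^ : ∀ x → headBit (when (isOdd x) Ξ ((φ ^ ⌊ x /2⌋) all-false)) ≡ isOdd x
  headBit-Ξ^ x = cong Vec.head (bits-when-Ξ k (isOdd x) _ (bits-φ^ ⌊ x /2⌋ all-false))

  Ξ^-separates : ∀ (i j : Fin (2 ℕ.* N)) → (Ξ ^ toℕ i) all-false ≡ (Ξ ^ toℕ j) all-false → i ≡ j
  Ξ^-separates i j eq = toℕ-injective (begin
    x                                   ≡⟨ n≡isOdd+⌊n/2⌋*2 x ⟩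
    bit (isOdd x) ℕ.+ ⌊ x /2⌋ ℕ.* 2     ≡⟨ cong₂ (λ b h → bit b ℕ.+ h ℕ.* 2) same-parity same-half ⟩
    bit (isOdd y) ℕ.+ ⌊ y /2⌋ ℕ.* 2     ≡⟨ n≡isOdd+⌊n/2⌋*2 y ⟨
    y                                   ∎)
    where
    open ≡-Reasoning
    x y : ℕ
    x = toℕ i
    y = toℕ j
    eq′ : when (isOdd x) Ξ ((φ ^ ⌊ x /2⌋) all-false) ≡ when (isOdd y) Ξ ((φ ^ ⌊ y /2⌋) all-false)
    eq′ = trans (sym (Ξ^-parity x all-false)) (trans eq (Ξ^-parity y all-false))
    same-parity : isOdd x ≡ isOdd y
    same-parity = trans (sym (headBit-Ξ^ x)) (trans (cong headBit eq′) (headBit-Ξ^ y))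
    half<N : ∀ (z : Fin (2 ℕ.* N)) → ⌊ toℕ z /2⌋ ℕ.< N
    half<N z = ⌊n/2⌋< (subst (toℕ z ℕ.<_) (ℕP.*-comm 2 N) (toℕ<n z))
    same-half : ⌊ x /2⌋ ≡ ⌊ y /2⌋
    same-half = φ^-injective all-false (half<N i) (half<N j)
      (when-injective Ξ Ξ-injective _ _ same-parity eq′)

  open DihedralAction (ℕ.pred (2 ℕ.* N)) Ξ-word (`ψ ∷ []) Ξ-period ψ-involutive ψ∘Ξ≡Ξ⁻¹∘ψ

  gen : Letter → D (2 ℕ.* N)
  gen `φ = 2 mod (2 ℕ.* N) , false
  gen `φ⁻¹ = suc K ℕ.* 2 mod (2 ℕ.* N) , false
  gen `ψ = 0 mod (2 ℕ.* N) , true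
  gen `τ = suc (k ℕ.* 2) mod (2 ℕ.* N) , true

  ρ-gen : ∀ l v → ⊤ → ρ (gen l) v ≡ apply l v
  ρ-gen `φ v _ = trans (ρ-mod 2 false v) (Ξ² v)
  ρ-gen `φ⁻¹ v _ = trans (ρ-mod (suc K ℕ.* 2) false v) (trans (Ξ^2t (suc K) v) (sym (φ⁻¹≡φ^K v)))
  ρ-gen `ψ v _ = ρ-mod 0 true v
  ρ-gen `τ v _ = begin
    ρ (gen `τ) v                       ≡⟨ ρ-mod (suc (k ℕ.* 2)) true v ⟩
    Ξ ((Ξ ^ (k ℕ.* 2)) (ψ v))          ≡⟨ cong Ξ (Ξ^2t k (ψ v)) ⟩
    Ξ ((φ ^ k) (ψ v))                  ≡⟨ ^-commute Ξ φ (λ u → sym (Ξ∘φ u)) k (ψ v) ⟨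
    (φ ^ k) (Ξ (ψ v))                  ≡⟨ τ≡φ^k∘Ξ∘ψ v ⟨
    τ v                                ∎
    where open ≡-Reasoning

  iso : A≅ N (suc m′) (D (2 ℕ.* N)) _·D_
  iso = FromFaithfulAction.iso
    (isFaithfulAction all-false t₁ all-false-isVertex t₁-isVertex ψ-fixes-all-false ψ-moves-t₁ Ξ^-separates)
    (λ _ → ⊤) _ _ gen ρ-gen word (λ g v _ → act-word g v)

odd-residue : ∀ K m → ¬ 2 ∣ suc K ⊎ ¬ 2 ∣ m → Σ ℕ λ k → ZMod._≈_ K (+ m) (+ 1 ℤ.+ (+ k ℤ.+ + k))
odd-residue K m odd with isOdd m | n≡isOdd+⌊n/2⌋*2 m
... | true | m≡1+a*2 = ⌊ m /2⌋ , ≈-reflexive (begin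
  + m                                 ≡⟨ cong +_ m≡1+a*2 ⟩
  + (1 ℕ.+ ⌊ m /2⌋ ℕ.* 2)             ≡⟨ ℤP.pos-+ 1 (⌊ m /2⌋ ℕ.* 2) ⟩
  + 1 ℤ.+ + (⌊ m /2⌋ ℕ.* 2)           ≡⟨ cong (ℤ._+_ (+ 1)) (ℤP.pos-* ⌊ m /2⌋ 2) ⟩
  + 1 ℤ.+ + ⌊ m /2⌋ ℤ.* + 2           ≡⟨ ring (+ ⌊ m /2⌋) ⟩
  + 1 ℤ.+ (+ ⌊ m /2⌋ ℤ.+ + ⌊ m /2⌋)   ∎)
  where
  open ZMod K
  open ≡-Reasoning
  ring : ∀ a → + 1 ℤ.+ a ℤ.* + 2 ≡ + 1 ℤ.+ (a ℤ.+ a)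
  ring = solve-∀
... | false | m≡a*2 with odd
...   | inj₂ m-odd = ⊥-elim (m-odd (divides ⌊ m /2⌋ m≡a*2))
...   | inj₁ N-odd with isOdd (suc K) | n≡isOdd+⌊n/2⌋*2 (suc K)
...     | false | N≡b*2 = ⊥-elim (N-odd (divides ⌊ suc K /2⌋ N≡b*2))
...     | true | N≡1+b*2 = a ℕ.+ b , ≈-intro ℤ.-1ℤ (begin
  + m                                                          ≡⟨ cong +_ m≡a*2 ⟩
  + (a ℕ.* 2)                                                  ≡⟨ ℤP.pos-* a 2 ⟩
  + a ℤ.* + 2                                                  ≡⟨ ring (+ a) (+ b) ⟩
  (+ 1 ℤ.+ ((+ a ℤ.+ + b) ℤ.+ (+ a ℤ.+ + b))) ℤ.+ ℤ.-1ℤ ℤ.* (+ 1 ℤ.+ + b ℤ.* + 2)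
      ≡⟨ cong₂ (λ s n → (+ 1 ℤ.+ (s ℤ.+ s)) ℤ.+ ℤ.-1ℤ ℤ.* n) (ℤP.pos-+ a b)
               (trans (cong +_ N≡1+b*2) (trans (ℤP.pos-+ 1 (b ℕ.* 2)) (cong (ℤ._+_ (+ 1)) (ℤP.pos-* b 2)))) ⟨
  (+ 1 ℤ.+ (+ (a ℕ.+ b) ℤ.+ + (a ℕ.+ b))) ℤ.+ ℤ.-1ℤ ℤ.* + suc K  ∎)
  where
  open ZMod K
  open ≡-Reasoning
  a b : ℕ
  a = ⌊ m /2⌋
  b = ⌊ suc K /2⌋
  ring : ∀ a b → a ℤ.* + 2 ≡ (+ 1 ℤ.+ ((a ℤ.+ b) ℤ.+ (a ℤ.+ b))) ℤ.+ ℤ.-1ℤ ℤ.* (+ 1 ℤ.+ b ℤ.* + 2)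
  ring = solve-∀

Aₙₘ≅D₂ₙ : (n m : ℕ) → 1 < n → 0 < m → (¬ (2 ∣ n) ⊎ ¬ (2 ∣ m)) → A≅ n m (D (2 * n)) _·D_
Aₙₘ≅D₂ₙ (suc zero) _ (s≤s ()) _ _
Aₙₘ≅D₂ₙ (suc (suc K)) (suc m′) _ _ odd with odd-residue (suc K) (suc m′) odd
... | k , m≈1+2k = OddCase.iso K m′ k m≈1+2k

Aₙₘ≅Dₙ×C₂ : (n m : ℕ) → 1 < n → 0 < m → 2 ∣ n → 2 ∣ m → A≅ n m (D n × C₂) (_·D_ ·× _·C₂_)
Aₙₘ≅Dₙ×C₂ (suc zero) _ (s≤s ()) _ _ _
Aₙₘ≅Dₙ×C₂ (suc (suc K)) (suc m′) _ _ _ (divides h m≡h*2) = EvenCase.iso K m′ h m≡h*2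

theorem6p4 : ((w : Word) → SameIn 1 0 w [])
    × A≅ 2 0 C₂ _·C₂_
    × A≅ 1 1 C₂ _·C₂_
    × ((n : ℕ) → 2 < n → A≅ n 0 (D n) _·D_)
    × ((m : ℕ) → 1 < m → A≅ 1 m (C₂ × C₂) (_·C₂_ ·× _·C₂_))
    × ((n m : ℕ) → 1 < n → 0 < m → (¬ (2 ∣ n) ⊎ ¬ (2 ∣ m)) → A≅ n m (D (2 * n)) _·D_)
    × ((n m : ℕ) → 1 < n → 0 < m → 2 ∣ n → 2 ∣ m → A≅ n m (D n × C₂) (_·D_ ·× _·C₂_))
theorem6p4 = A₁₀-trivial , A₂₀≅C₂ , A₁₁≅C₂ , Aₙ₀≅Dₙ , A₁ₘ≅C₂×C₂ , Aₙₘ≅D₂ₙ , Aₙₘ≅Dₙ×C₂
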